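{- Let $T$ be a tree with $n$ vertices. Then $\operatorname{avd}(T) \ge \operatorname{avd}(K_{1,n-1})$, with equality if and only if $T \cong K_{1,n-1}$.
   Context: $K_{1,n-1}$ is the star on $n$ vertices. A set $S \subseteq V(G)$ is a dominating set of a graph $G$ if every vertex of $G$ is in $S$ or adjacent to a vertex of $S$. Let $\mathcal{D}(G)$ be the collection of dominating sets of $G$. The average order of dominating sets is $\operatorname{avd}(G) = \frac{1}{|\mathcal{D}(G)|}\sum_{S \in \mathcal{D}(G)} |S|$. -}

module Defs where

open import Data.Nat using (ℕ; zero; suc; _≤_)
open import Data.Integer using (+_)
open import Data.Rational using (ℚ; _/_; 0ℚ)
open import Data.Bool using (Bool; true; false; _∧_; _∨_; not; if_then_else_)
open import Data.Fin using (Fin; zero; suc)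
open import Data.Fin.Subset using (Subset; ∣_∣)
open import Data.Fin.Permutation using (Permutation′; _⟨$⟩ʳ_)
open import Data.Vec using (Vec; []; _∷_; lookup)
open import Data.List using (List; []; _∷_; [_]; map; _++_; filter; length; take)
open import Data.Nat.ListAction using (sum)
open import Data.List.Relation.Unary.Unique.Propositional using (Unique)
open import Data.Product using (Σ; _×_; ∃)
open import Relation.Binary.PropositionalEquality using (_≡_)
open import Relation.Nullary.Decidable using (Dec)
open import Data.Bool.Properties using (T?)
open import Data.Bool using (T)

record Graph (n : ℕ) : Set where
  field
    adj    : Fin n → Fin n → Bool
    sym    : ∀ u v → adj u v ≡ adj v u
    irrefl : ∀ v → adj v v ≡ false
open Graph public

data Walk {n : ℕ} (G : Graph n) : Fin n → Fin n → Set where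
  here : ∀ {u} → Walk G u u
  step : ∀ {u w v} → adj G u w ≡ true → Walk G w v → Walk G u v

Connected : ∀ {n} → Graph n → Set
Connected {n} G = ∀ (u v : Fin n) → Walk G u v

Chain : ∀ {n} → Graph n → List (Fin n) → Set
Chain G []             = Data.Unit.⊤
  where import Data.Unit
Chain G (x ∷ [])       = Data.Unit.⊤
  where import Data.Unit
Chain G (x ∷ y ∷ xs)   = (adj G x y ≡ true) × Chain G (y ∷ xs)

-- a cycle: at least 3 distinct vertices x0..xk, consecutive ones adjacent, and xk adjacent to x0
HasCycle : ∀ {n} → Graph n → Set
HasCycle {n} G = Σ (List (Fin n)) λ xs →
  (3 ≤ length xs) × Unique xs × Chain G (xs ++ take 1 xs)

-- tree = connected acyclic graph (with at least one vertex, imposed in the statement)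
IsTree : ∀ {n} → Graph n → Set
IsTree G = Connected G × (HasCycle G → Data.Empty.⊥)
  where import Data.Empty

_≅_ : ∀ {n} → Graph n → Graph n → Set
_≅_ {n} G H = Σ (Permutation′ n) λ σ →
  ∀ u v → adj G u v ≡ adj H (σ ⟨$⟩ʳ u) (σ ⟨$⟩ʳ v)

-- the star K_{1,n-1} on vertex set Fin (suc m), centre 0
isZero : ∀ {n} → Fin n → Bool
isZero zero    = true
isZero (suc _) = false

star-adj : ∀ {n} → Fin n → Fin n → Bool
star-adj u v = (isZero u ∧ not (isZero v)) ∨ (not (isZero u) ∧ isZero v)

star : (n : ℕ) → Graph n
star n = record { adj = star-adj ; sym = s ; irrefl = i }
  where
  s : ∀ u v → star-adj u v ≡ star-adj v u
  s zero zero = _≡_.refl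
  s zero (suc v) = _≡_.refl
  s (suc u) zero = _≡_.refl
  s (suc u) (suc v) = _≡_.refl
  i : ∀ v → star-adj v v ≡ false
  i zero = _≡_.refl
  i (suc v) = _≡_.refl

allSubsets : (n : ℕ) → List (Subset n)
allSubsets zero    = [ [] ]
allSubsets (suc n) = map (true ∷_) (allSubsets n) ++ map (false ∷_) (allSubsets n)

anyFin : ∀ {n} → (Fin n → Bool) → Bool
anyFin {zero}  p = false
anyFin {suc n} p = p zero ∨ anyFin (λ i → p (suc i))

allFin : ∀ {n} → (Fin n → Bool) → Bool
allFin {zero}  p = true
allFin {suc n} p = p zero ∧ allFin (λ i → p (suc i))

isDominating : ∀ {n} → Graph n → Subset n → Bool
isDominating G S = allFin λ v → lookup S v ∨ anyFin (λ u → lookup S u ∧ adj G u v)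

dominatingSets : ∀ {n} → Graph n → List (Subset n)
dominatingSets {n} G = filter (λ S → T? (isDominating G S)) (allSubsets n)

-- a / b as a rational (b = 0 never occurs below: V(G) itself is always dominating)
ratio : ℕ → ℕ → ℚ
ratio a zero    = 0ℚ
ratio a (suc b) = (+ a) / suc b

avd : ∀ {n} → Graph n → ℚ
avd G = ratio (sum (map ∣_∣ (dominatingSets G))) (length (dominatingSets G))

module Submission where

-- Write D(G) for the number of dominating sets of G and X(v) for the number of
-- those containing v; the total size of all dominating sets is Σ_v X(v).
-- Domination is upward closed, so toggling v injects the dominating sets missing v
-- into those containing v, whence D ≤ 2·X(v).  If ℓ is a leaf hanging from p, every
-- dominating set meets {ℓ,p}, and the same injection gives 4·D ≤ 3·(X(ℓ) + X(p)).
-- Summing over all vertices, a graph with two disjoint pendant edges satisfies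
-- (3n+4)·D ≤ 6·Σ_v X(v), i.e. avd ≥ (3n+4)/6.  For the star both counts are explicit
-- and avd(K_{1,n-1}) < (3n+4)/6.  A tree is either a star (with any centre) or
-- contains a path on four vertices, and extending such a path maximally in both
-- directions exhibits two disjoint pendant edges.  Stars with any centre have the
-- same counts, which gives the equality case.

open import Defs
open import Data.Nat using (ℕ; zero; suc; _+_; _*_; _≤_; _<_; _∸_; z≤n; s≤s; _^_; _≤?_)
open import Data.Nat.Properties hiding (_≟_)
open import Data.Nat.ListAction using (sum)
open import Data.Nat.ListAction.Properties using (sum-++)
open import Data.Nat.Tactic.RingSolver using (solve-∀)
open import Algebra.Properties.CommutativeSemigroup +-commutativeSemigroup
  using () renaming (interchange to +-interchange; x∙yz≈y∙xz to +-left-comm)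
open import Data.Bool using (Bool; true; false; _∧_; _∨_; not; if_then_else_)
open import Data.Bool.Properties using (T?; not-involutive; ∧-zeroʳ; ⇔→≡) renaming (_≟_ to _≟ᵇ_)
open import Data.Fin using (Fin; zero; suc; _≟_)
import Data.Fin.Properties as FinP
open import Data.Fin.Subset using (Subset; ∣_∣)
open import Data.Fin.Permutation using (_⟨$⟩ʳ_; _⟨$⟩ˡ_; inverseˡ; inverseʳ)
import Data.Fin.Permutation as Perm
import Data.Fin.Permutation.Components as PC
open import Data.Vec using ([]; _∷_; lookup)
open import Data.List using (List; []; _∷_; map; _++_; filter; length; reverse)
  renaming (lookup to lookupL)
import Data.List
open import Data.List.Properties
  using (++-assoc; ++-identityʳ; reverse-++; length-reverse; length-++; map-++; map-∘; map-cong-local)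
open import Data.List.Relation.Unary.Unique.Propositional using (Unique)
open import Data.List.Relation.Unary.AllPairs using ([]; _∷_)
open import Data.List.Relation.Unary.All using (All; []; _∷_) renaming (map to mapAll)
import Data.List.Relation.Unary.All.Properties as AllP
open import Data.List.Relation.Unary.All.Properties.Core using (¬Any⇒All¬)
open import Data.List.Relation.Unary.Any using (here; there)
open import Data.List.Membership.Propositional using (_∈_)
import Data.List.Relation.Binary.Permutation.Setoid as PS
import Data.List.Relation.Binary.Permutation.Setoid.Properties as PSP
open import Relation.Binary.PropositionalEquality hiding (sym)
import Relation.Binary.PropositionalEquality as ≡
open import Data.Product using (Σ; _×_; _,_; proj₁; proj₂)
open import Data.Sum using (_⊎_; inj₁; inj₂)
open import Data.Empty using (⊥; ⊥-elim)
open import Data.Unit using (⊤; tt)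
open import Relation.Nullary using (yes; no; _×-dec_; ¬?)
open import Data.Integer using (+<+)
import Data.Integer as ℤ
import Data.Integer.Properties as ℤP
import Data.Rational as ℚ
import Data.Rational.Properties as ℚP
import Data.Rational.Unnormalised as ℚᵘ
import Data.Rational.Unnormalised.Properties as ℚᵘP
open import Function.Bundles using (_⇔_; mk⇔)

⟦_⟧ : Bool → ℕ
⟦ true ⟧  = 1
⟦ false ⟧ = 0

ΣS : ∀ {n} → (Subset n → ℕ) → ℕ
ΣS {zero}  f = f []
ΣS {suc n} f = ΣS (λ S → f (true ∷ S)) + ΣS (λ S → f (false ∷ S))

ΣS-cong : ∀ {n} {f g : Subset n → ℕ} → (∀ S → f S ≡ g S) → ΣS f ≡ ΣS g
ΣS-cong {zero}  h = h []
ΣS-cong {suc n} h = cong₂ _+_ (ΣS-cong (λ S → h (true ∷ S))) (ΣS-cong (λ S → h (false ∷ S)))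

ΣS-mono : ∀ {n} {f g : Subset n → ℕ} → (∀ S → f S ≤ g S) → ΣS f ≤ ΣS g
ΣS-mono {zero}  h = h []
ΣS-mono {suc n} h = +-mono-≤ (ΣS-mono (λ S → h (true ∷ S))) (ΣS-mono (λ S → h (false ∷ S)))

ΣS-+ : ∀ {n} (f g : Subset n → ℕ) → ΣS (λ S → f S + g S) ≡ ΣS f + ΣS g
ΣS-+ {zero}  f g = refl
ΣS-+ {suc n} f g = begin
  ΣS (λ S → f (true ∷ S) + g (true ∷ S)) + ΣS (λ S → f (false ∷ S) + g (false ∷ S))
    ≡⟨ cong₂ _+_ (ΣS-+ (λ S → f (true ∷ S)) (λ S → g (true ∷ S)))
                 (ΣS-+ (λ S → f (false ∷ S)) (λ S → g (false ∷ S))) ⟩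
  (ΣS (λ S → f (true ∷ S)) + ΣS (λ S → g (true ∷ S))) + (ΣS (λ S → f (false ∷ S)) + ΣS (λ S → g (false ∷ S)))
    ≡⟨ +-interchange (ΣS (λ S → f (true ∷ S))) (ΣS (λ S → g (true ∷ S))) _ _ ⟩
  ΣS f + ΣS g ∎
  where open ≡-Reasoning

ΣS-* : ∀ {n} (k : ℕ) (f : Subset n → ℕ) → ΣS (λ S → k * f S) ≡ k * ΣS f
ΣS-* {zero}  k f = refl
ΣS-* {suc n} k f = trans (cong₂ _+_ (ΣS-* k (λ S → f (true ∷ S))) (ΣS-* k (λ S → f (false ∷ S))))
                         (≡.sym (*-distribˡ-+ k _ _))

ΣS-zero : ∀ {n} → ΣS {n} (λ _ → 0) ≡ 0
ΣS-zero {zero}  = refl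
ΣS-zero {suc n} = cong₂ _+_ (ΣS-zero {n}) (ΣS-zero {n})

ΣS-one : ∀ n → ΣS {n} (λ _ → 1) ≡ 2 ^ n
ΣS-one zero    = refl
ΣS-one (suc n) = cong₂ _+_ (ΣS-one n) (trans (ΣS-one n) (≡.sym (+-identityʳ (2 ^ n))))

ΣS-term : ∀ {n} (f : Subset n → ℕ) S → f S ≤ ΣS f
ΣS-term {zero}  f []          = ≤-refl
ΣS-term {suc n} f (true ∷ S)  = ≤-trans (ΣS-term (λ S → f (true ∷ S)) S) (m≤m+n _ _)
ΣS-term {suc n} f (false ∷ S) = ≤-trans (ΣS-term (λ S → f (false ∷ S)) S) (m≤n+m _ _)

flipAt : ∀ {n} → Fin n → Subset n → Subset n
flipAt zero    (b ∷ S) = not b ∷ S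
flipAt (suc v) (b ∷ S) = b ∷ flipAt v S

-- Toggling is a bijection on subsets, so it does not change sums.
ΣS-flip : ∀ {n} (v : Fin n) (f : Subset n → ℕ) → ΣS (λ S → f (flipAt v S)) ≡ ΣS f
ΣS-flip {suc n} zero    f = +-comm (ΣS (λ S → f (false ∷ S))) (ΣS (λ S → f (true ∷ S)))
ΣS-flip {suc n} (suc v) f = cong₂ _+_ (ΣS-flip v (λ S → f (true ∷ S))) (ΣS-flip v (λ S → f (false ∷ S)))

lookup-flip-same : ∀ {n} (v : Fin n) S → lookup (flipAt v S) v ≡ not (lookup S v)
lookup-flip-same zero    (b ∷ S) = refl
lookup-flip-same (suc v) (b ∷ S) = lookup-flip-same v S

lookup-flip-other : ∀ {n} (v u : Fin n) S → u ≢ v → lookup (flipAt v S) u ≡ lookup S u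
lookup-flip-other zero    zero    (b ∷ S) ne = ⊥-elim (ne refl)
lookup-flip-other zero    (suc u) (b ∷ S) ne = refl
lookup-flip-other (suc v) zero    (b ∷ S) ne = refl
lookup-flip-other (suc v) (suc u) (b ∷ S) ne = lookup-flip-other v u S (λ e → ne (cong suc e))

_⊆ₛ_ : ∀ {n} → Subset n → Subset n → Set
S ⊆ₛ S′ = ∀ u → lookup S u ≡ true → lookup S′ u ≡ true

UpClosed : ∀ {n} → (Subset n → Bool) → Set
UpClosed {n} F = ∀ (S S′ : Subset n) → S ⊆ₛ S′ → F S ≡ true → F S′ ≡ true

flip-⊆ : ∀ {n} (v : Fin n) S → lookup S v ≡ true → flipAt v S ⊆ₛ S
flip-⊆ v S Sv u h with u ≟ v
... | yes refl = Sv
... | no  ne   = subst (_≡ true) (lookup-flip-other v u S ne) h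

-- The flip injection: for an upward-closed F and a weight h that ignores v,
-- the members of F avoiding v weigh at most as much as those containing v
-- (adding v maps the former injectively into the latter).
flip-injection : ∀ {n} (F : Subset n → Bool) → UpClosed F → (v : Fin n) (h : Subset n → ℕ) →
  (∀ S → h (flipAt v S) ≡ h S) →
  ΣS (λ S → ⟦ F S ⟧ * ⟦ not (lookup S v) ⟧ * h S) ≤ ΣS (λ S → ⟦ F S ⟧ * ⟦ lookup S v ⟧ * h S)
flip-injection F up v h h-flip = begin
    ΣS (λ S → ⟦ F S ⟧ * ⟦ not (lookup S v) ⟧ * h S)
      ≡⟨ ≡.sym (ΣS-flip v _) ⟩
    ΣS (λ S → ⟦ F (flipAt v S) ⟧ * ⟦ not (lookup (flipAt v S) v) ⟧ * h (flipAt v S))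
      ≡⟨ ΣS-cong (λ S → cong₂ (λ a b → ⟦ F (flipAt v S) ⟧ * ⟦ a ⟧ * b)
                   (trans (cong not (lookup-flip-same v S)) (not-involutive (lookup S v))) (h-flip S)) ⟩
    ΣS (λ S → ⟦ F (flipAt v S) ⟧ * ⟦ lookup S v ⟧ * h S)
      ≤⟨ ΣS-mono added ⟩
    ΣS (λ S → ⟦ F S ⟧ * ⟦ lookup S v ⟧ * h S) ∎
  where
  open ≤-Reasoning
  -- if v ∈ S and S minus v is in F, then so is S
  added : ∀ S → ⟦ F (flipAt v S) ⟧ * ⟦ lookup S v ⟧ * h S ≤ ⟦ F S ⟧ * ⟦ lookup S v ⟧ * h S
  added S with lookup S v in Sv
  ... | false = ≤-reflexive (cong (_* h S) (trans (*-zeroʳ ⟦ F (flipAt v S) ⟧) (≡.sym (*-zeroʳ ⟦ F S ⟧))))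
  ... | true with F (flipAt v S) in F-S
  ...   | false = z≤n
  ...   | true  rewrite up (flipAt v S) S (flip-⊆ v S Sv) F-S = ≤-refl

ΣV : ∀ {n} → (Fin n → ℕ) → ℕ
ΣV {zero}  f = 0
ΣV {suc n} f = f zero + ΣV (λ i → f (suc i))

ΣV-cong : ∀ {n} {f g : Fin n → ℕ} → (∀ v → f v ≡ g v) → ΣV f ≡ ΣV g
ΣV-cong {zero}  h = refl
ΣV-cong {suc n} h = cong₂ _+_ (h zero) (ΣV-cong (λ i → h (suc i)))

ΣV-+ : ∀ {n} (f g : Fin n → ℕ) → ΣV (λ v → f v + g v) ≡ ΣV f + ΣV g
ΣV-+ {zero}  f g = refl
ΣV-+ {suc n} f g = trans (cong (f zero + g zero +_) (ΣV-+ (λ i → f (suc i)) (λ i → g (suc i))))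
                         (+-interchange (f zero) (g zero) _ _)

ΣV-* : ∀ {n} (k : ℕ) (f : Fin n → ℕ) → ΣV (λ v → k * f v) ≡ k * ΣV f
ΣV-* {zero}  k f = ≡.sym (*-zeroʳ k)
ΣV-* {suc n} k f = trans (cong (k * f zero +_) (ΣV-* k (λ i → f (suc i))))
                         (≡.sym (*-distribˡ-+ k (f zero) _))

ΣV-const : ∀ n (k : ℕ) → ΣV {n} (λ _ → k) ≡ n * k
ΣV-const zero    k = refl
ΣV-const (suc n) k = cong (k +_) (ΣV-const n k)

ΣS-ΣV : ∀ {n m} (g : Subset n → Fin m → ℕ) → ΣS (λ S → ΣV (g S)) ≡ ΣV (λ v → ΣS (λ S → g S v))
ΣS-ΣV {n} {zero}  g = ΣS-zero {n}
ΣS-ΣV {n} {suc m} g = trans (ΣS-+ (λ S → g S zero) (λ S → ΣV (λ i → g S (suc i))))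
  (cong (ΣS (λ S → g S zero) +_) (ΣS-ΣV (λ S i → g S (suc i))))

size-ΣV : ∀ {n} (S : Subset n) → ∣ S ∣ ≡ ΣV (λ v → ⟦ lookup S v ⟧)
size-ΣV []          = refl
size-ΣV (true ∷ S)  = cong suc (size-ΣV S)
size-ΣV (false ∷ S) = size-ΣV S

_==_ : ∀ {n} → Fin n → Fin n → Bool
zero  == zero  = true
zero  == suc _ = false
suc _ == zero  = false
suc a == suc b = a == b

==-refl : ∀ {n} (a : Fin n) → (a == a) ≡ true
==-refl zero    = refl
==-refl (suc a) = ==-refl a

==-true : ∀ {n} (a b : Fin n) → (a == b) ≡ true → a ≡ b
==-true zero    zero    e = refl
==-true (suc a) (suc b) e = cong suc (==-true a b e)

==-false : ∀ {n} (a b : Fin n) → a ≢ b → (a == b) ≡ false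
==-false zero    zero    ne = ⊥-elim (ne refl)
==-false zero    (suc b) ne = refl
==-false (suc a) zero    ne = refl
==-false (suc a) (suc b) ne = ==-false a b (λ e → ne (cong suc e))

erase : ∀ {n} → Fin n → (Fin n → ℕ) → Fin n → ℕ
erase a f v = if v == a then 0 else f v

ΣV-erase : ∀ {n} (a : Fin n) (f : Fin n → ℕ) → ΣV f ≡ f a + ΣV (erase a f)
ΣV-erase zero    f = refl
ΣV-erase (suc a) f = trans (cong (f zero +_) (ΣV-erase a (λ i → f (suc i))))
                           (+-left-comm (f zero) (f (suc a)) _)

ΣV-distinct : ∀ {n} (f : Fin n → ℕ) (xs : List (Fin n)) → Unique xs → sum (map f xs) ≤ ΣV f
ΣV-distinct f []       []          = z≤n
ΣV-distinct f (x ∷ xs) (x∉ ∷ uniq) = begin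
    f x + sum (map f xs)          ≡⟨ cong (λ ys → f x + sum ys) (map-cong-local (mapAll unerased x∉)) ⟩
    f x + sum (map (erase x f) xs) ≤⟨ +-monoʳ-≤ (f x) (ΣV-distinct (erase x f) xs uniq) ⟩
    f x + ΣV (erase x f)           ≡⟨ ≡.sym (ΣV-erase x f) ⟩
    ΣV f ∎
  where
  open ≤-Reasoning
  unerased : ∀ {y} → x ≢ y → f y ≡ erase x f y
  unerased {y} x≢y = cong (λ b → if b then 0 else f y) (≡.sym (==-false y x (λ e → x≢y (≡.sym e))))

isDom : ∀ {n} → (Fin n → Fin n → Bool) → Subset n → Bool
isDom A S = allFin λ v → lookup S v ∨ anyFin (λ u → lookup S u ∧ A u v)

domCount : ∀ {n} → (Fin n → Fin n → Bool) → ℕ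
domCount A = ΣS (λ S → ⟦ isDom A S ⟧)

domSize : ∀ {n} → (Fin n → Fin n → Bool) → ℕ
domSize A = ΣS (λ S → ⟦ isDom A S ⟧ * ∣ S ∣)

sum-allSubsets : ∀ n (f : Subset n → ℕ) → sum (map f (allSubsets n)) ≡ ΣS f
sum-allSubsets zero    f = +-identityʳ (f [])
sum-allSubsets (suc n) f = begin
  sum (map f (map (true ∷_) L ++ map (false ∷_) L))
    ≡⟨ cong sum (map-++ f (map (true ∷_) L) (map (false ∷_) L)) ⟩
  sum (map f (map (true ∷_) L) ++ map f (map (false ∷_) L))
    ≡⟨ sum-++ (map f (map (true ∷_) L)) _ ⟩
  sum (map f (map (true ∷_) L)) + sum (map f (map (false ∷_) L))
    ≡⟨ cong₂ _+_ (trans (cong sum (≡.sym (map-∘ L))) (sum-allSubsets n _))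
                 (trans (cong sum (≡.sym (map-∘ L))) (sum-allSubsets n _)) ⟩
  ΣS (λ S → f (true ∷ S)) + ΣS (λ S → f (false ∷ S)) ∎
  where
  open ≡-Reasoning
  L = allSubsets n

length-filter : ∀ {X : Set} (P : X → Bool) xs →
  length (filter (λ x → T? (P x)) xs) ≡ sum (map (λ x → ⟦ P x ⟧) xs)
length-filter P []       = refl
length-filter P (x ∷ xs) with P x
... | true  = cong suc (length-filter P xs)
... | false = length-filter P xs

sum-filter : ∀ {X : Set} (P : X → Bool) (g : X → ℕ) xs →
  sum (map g (filter (λ x → T? (P x)) xs)) ≡ sum (map (λ x → ⟦ P x ⟧ * g x) xs)
sum-filter P g []       = refl
sum-filter P g (x ∷ xs) with P x
... | true  = cong₂ _+_ (≡.sym (+-identityʳ (g x))) (sum-filter P g xs)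
... | false = sum-filter P g xs

avd-sums : ∀ {n} (G : Graph n) → avd G ≡ ratio (domSize (adj G)) (domCount (adj G))
avd-sums {n} G = cong₂ ratio
  (trans (sum-filter (isDominating G) ∣_∣ (allSubsets n)) (sum-allSubsets n _))
  (trans (length-filter (isDominating G) (allSubsets n)) (sum-allSubsets n _))

allFin-cong : ∀ {n} {p q : Fin n → Bool} → (∀ i → p i ≡ q i) → allFin p ≡ allFin q
allFin-cong {zero}  h = refl
allFin-cong {suc n} h = cong₂ _∧_ (h zero) (allFin-cong (λ i → h (suc i)))

anyFin-cong : ∀ {n} {p q : Fin n → Bool} → (∀ i → p i ≡ q i) → anyFin p ≡ anyFin q
anyFin-cong {zero}  h = refl
anyFin-cong {suc n} h = cong₂ _∨_ (h zero) (anyFin-cong (λ i → h (suc i)))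

allFin-elim : ∀ {n} (p : Fin n → Bool) → allFin p ≡ true → ∀ i → p i ≡ true
allFin-elim {suc n} p h zero with p zero
... | true = refl
allFin-elim {suc n} p h (suc i) with p zero
... | true = allFin-elim (λ j → p (suc j)) h i

allFin-intro : ∀ {n} (p : Fin n → Bool) → (∀ i → p i ≡ true) → allFin p ≡ true
allFin-intro {zero}  p h = refl
allFin-intro {suc n} p h rewrite h zero = allFin-intro (λ j → p (suc j)) (λ j → h (suc j))

anyFin-elim : ∀ {n} (p : Fin n → Bool) → anyFin p ≡ true → Σ (Fin n) λ i → p i ≡ true
anyFin-elim {suc n} p h with p zero in e
... | true  = zero , e
... | false with anyFin-elim (λ j → p (suc j)) h
... | i , e′ = suc i , e′

anyFin-intro : ∀ {n} (p : Fin n → Bool) (i : Fin n) → p i ≡ true → anyFin p ≡ true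
anyFin-intro {suc n} p zero h rewrite h = refl
anyFin-intro {suc n} p (suc i) h with p zero
... | true  = refl
... | false = anyFin-intro (λ j → p (suc j)) i h

∨-elim : ∀ a b → a ∨ b ≡ true → (a ≡ true) ⊎ (b ≡ true)
∨-elim true  b h = inj₁ refl
∨-elim false b h = inj₂ h

∧-elim : ∀ a b → a ∧ b ≡ true → (a ≡ true) × (b ≡ true)
∧-elim true true h = refl , refl

∨-introʳ : ∀ a b → b ≡ true → a ∨ b ≡ true
∨-introʳ true  b h = refl
∨-introʳ false b h = h

Covered : ∀ {n} → (Fin n → Fin n → Bool) → Subset n → Fin n → Set
Covered {n} A S v = (lookup S v ≡ true) ⊎ (Σ (Fin n) λ u → lookup S u ≡ true × A u v ≡ true)

dominator : ∀ {n} (A : Fin n → Fin n → Bool) S → isDom A S ≡ true → ∀ v → Covered A S v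
dominator A S dom v with ∨-elim _ _ (allFin-elim _ dom v)
... | inj₁ Sv = inj₁ Sv
... | inj₂ h with anyFin-elim _ h
... | u , Su∧Auv = inj₂ (u , ∧-elim _ _ Su∧Auv)

dominates : ∀ {n} (A : Fin n → Fin n → Bool) S → (∀ v → Covered A S v) → isDom A S ≡ true
dominates A S h = allFin-intro _ λ v → covered v (h v)
  where
  covered : ∀ v → Covered A S v → lookup S v ∨ anyFin (λ u → lookup S u ∧ A u v) ≡ true
  covered v (inj₁ Sv) rewrite Sv = refl
  covered v (inj₂ (u , Su , Auv)) = ∨-introʳ _ _ (anyFin-intro _ u (cong₂ _∧_ Su Auv))

isDom-cong : ∀ {n} (A B : Fin n → Fin n → Bool) → (∀ u v → A u v ≡ B u v) → ∀ S → isDom A S ≡ isDom B S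
isDom-cong A B h S =
  allFin-cong (λ v → cong (lookup S v ∨_) (anyFin-cong (λ u → cong (lookup S u ∧_) (h u v))))

counts-cong : ∀ {n} (A B : Fin n → Fin n → Bool) → (∀ u v → A u v ≡ B u v) →
  domSize A ≡ domSize B × domCount A ≡ domCount B
counts-cong A B h = ΣS-cong (λ S → cong (λ b → ⟦ b ⟧ * ∣ S ∣) (isDom-cong A B h S))
                  , ΣS-cong (λ S → cong ⟦_⟧ (isDom-cong A B h S))

isDom-upClosed : ∀ {n} (A : Fin n → Fin n → Bool) → UpClosed (isDom A)
isDom-upClosed A S S′ S⊆S′ dom = dominates A S′ λ v → enlarge (dominator A S dom v)
  where
  enlarge : ∀ {v} → Covered A S v → Covered A S′ v
  enlarge (inj₁ Sv)             = inj₁ (S⊆S′ _ Sv)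
  enlarge (inj₂ (u , Su , Auv)) = inj₂ (u , S⊆S′ u Su , Auv)

-- The whole vertex set dominates, so D ≥ 1.
full : ∀ {n} → Subset n
full {zero}  = []
full {suc n} = true ∷ full

lookup-full : ∀ {n} (v : Fin n) → lookup full v ≡ true
lookup-full zero    = refl
lookup-full (suc v) = lookup-full v

domCount-pos : ∀ {n} (A : Fin n → Fin n → Bool) → Σ ℕ λ d → domCount A ≡ suc d
domCount-pos A with domCount A | ΣS-term (λ S → ⟦ isDom A S ⟧) full
... | suc d | _ = d , refl
... | zero  | h rewrite dominates A full (λ v → inj₁ (lookup-full v)) with h
...   | ()

Pendant : ∀ {n} → (Fin n → Fin n → Bool) → Fin n → Fin n → Set
Pendant A ℓ p = ∀ u → A u ℓ ≡ true → u ≡ p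

pendant-dom : ∀ {n} (A : Fin n → Fin n → Bool) {ℓ p} → Pendant A ℓ p →
  ∀ S → isDom A S ≡ true → lookup S ℓ ∨ lookup S p ≡ true
pendant-dom A {ℓ} pend S dom with dominator A S dom ℓ
... | inj₁ Sℓ rewrite Sℓ = refl
... | inj₂ (u , Su , Auℓ) with pend u Auℓ
... | refl = ∨-introʳ _ _ Su

record TwoPendantEdges {n : ℕ} (A : Fin n → Fin n → Bool) : Set where
  field
    ℓ₁ p₁ p₂ ℓ₂ : Fin n
    distinct    : Unique (ℓ₁ ∷ p₁ ∷ p₂ ∷ ℓ₂ ∷ [])
    pendant₁    : Pendant A ℓ₁ p₁
    pendant₂    : Pendant A ℓ₂ p₂

module Counting {n : ℕ} (A : Fin n → Fin n → Bool) where

  private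
    F : Subset n → Bool
    F = isDom A

  X : Fin n → ℕ
  X v = ΣS (λ S → ⟦ F S ⟧ * ⟦ lookup S v ⟧)

  domSize-X : domSize A ≡ ΣV X
  domSize-X = begin
    ΣS (λ S → ⟦ F S ⟧ * ∣ S ∣)
      ≡⟨ ΣS-cong (λ S → trans (cong (⟦ F S ⟧ *_) (size-ΣV S)) (≡.sym (ΣV-* ⟦ F S ⟧ (λ v → ⟦ lookup S v ⟧)))) ⟩
    ΣS (λ S → ΣV (λ v → ⟦ F S ⟧ * ⟦ lookup S v ⟧))
      ≡⟨ ΣS-ΣV (λ S v → ⟦ F S ⟧ * ⟦ lookup S v ⟧) ⟩
    ΣV X ∎
    where open ≡-Reasoning

  -- D ≤ 2·X(v): the dominating sets avoiding v inject into those containing v.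
  vertex-bound : ∀ v → domCount A ≤ 2 * X v
  vertex-bound v = begin
    ΣS (λ S → ⟦ F S ⟧)
      ≡⟨ ΣS-cong (λ S → split (F S) (lookup S v)) ⟩
    ΣS (λ S → ⟦ F S ⟧ * ⟦ not (lookup S v) ⟧ * 1 + ⟦ F S ⟧ * ⟦ lookup S v ⟧ * 1)
      ≡⟨ ΣS-+ {n} _ _ ⟩
    ΣS (λ S → ⟦ F S ⟧ * ⟦ not (lookup S v) ⟧ * 1) + ΣS (λ S → ⟦ F S ⟧ * ⟦ lookup S v ⟧ * 1)
      ≤⟨ +-monoˡ-≤ _ (flip-injection F (isDom-upClosed A) v (λ _ → 1) (λ _ → refl)) ⟩
    ΣS (λ S → ⟦ F S ⟧ * ⟦ lookup S v ⟧ * 1) + ΣS (λ S → ⟦ F S ⟧ * ⟦ lookup S v ⟧ * 1)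
      ≡⟨ cong (λ x → x + x) (ΣS-cong (λ S → *-identityʳ (⟦ F S ⟧ * ⟦ lookup S v ⟧))) ⟩
    X v + X v
      ≡⟨ cong (X v +_) (≡.sym (+-identityʳ (X v))) ⟩
    2 * X v ∎
    where
    open ≤-Reasoning
    split : ∀ f b → ⟦ f ⟧ ≡ ⟦ f ⟧ * ⟦ not b ⟧ * 1 + ⟦ f ⟧ * ⟦ b ⟧ * 1
    split false b     = refl
    split true  false = refl
    split true  true  = refl

  -- 4·D ≤ 3·(X(ℓ) + X(p)) for ℓ pendant at p.  With a (resp. b) the number of
  -- dominating sets containing ℓ but not p (resp. p but not ℓ) and e the number
  -- containing both, D = a + b + e since no dominating set misses both, and the flip
  -- injection gives a ≤ e and b ≤ e.
  pair-bound : ∀ {ℓ p} → ℓ ≢ p → Pendant A ℓ p → 4 * domCount A ≤ 3 * (X ℓ + X p)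
  pair-bound {ℓ} {p} ℓ≢p pend =
    +-cancelʳ-≤ (ΣS a + ΣS b) (4 * domCount A) (3 * (X ℓ + X p)) (begin
      4 * domCount A + (ΣS a + ΣS b)
        ≤⟨ +-monoʳ-≤ (4 * domCount A) (+-mono-≤ a≤e b≤e′) ⟩
      4 * domCount A + (ΣS e + ΣS e′)
        ≡⟨ ≡.sym (cong₂ _+_ (ΣS-* {n} 4 _) (ΣS-+ {n} e e′)) ⟩
      ΣS (λ S → 4 * ⟦ F S ⟧) + ΣS (λ S → e S + e′ S)
        ≡⟨ ≡.sym (ΣS-+ {n} _ _) ⟩
      ΣS (λ S → 4 * ⟦ F S ⟧ + (e S + e′ S))
        ≡⟨ ≡.sym (ΣS-cong pointwise) ⟩
      ΣS (λ S → 3 * (⟦ F S ⟧ * ⟦ lookup S ℓ ⟧ + ⟦ F S ⟧ * ⟦ lookup S p ⟧) + (a S + b S))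
        ≡⟨ ΣS-+ {n} _ _ ⟩
      ΣS (λ S → 3 * (⟦ F S ⟧ * ⟦ lookup S ℓ ⟧ + ⟦ F S ⟧ * ⟦ lookup S p ⟧)) + ΣS (λ S → a S + b S)
        ≡⟨ cong₂ _+_ (trans (ΣS-* {n} 3 _) (cong (3 *_) (ΣS-+ {n} _ _))) (ΣS-+ {n} a b) ⟩
      3 * (X ℓ + X p) + (ΣS a + ΣS b) ∎)
    where
    open ≤-Reasoning
    a b e e′ : Subset n → ℕ
    a  S = ⟦ F S ⟧ * ⟦ not (lookup S p) ⟧ * ⟦ lookup S ℓ ⟧
    e  S = ⟦ F S ⟧ * ⟦ lookup S p ⟧ * ⟦ lookup S ℓ ⟧
    b  S = ⟦ F S ⟧ * ⟦ not (lookup S ℓ) ⟧ * ⟦ lookup S p ⟧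
    e′ S = ⟦ F S ⟧ * ⟦ lookup S ℓ ⟧ * ⟦ lookup S p ⟧
    a≤e : ΣS a ≤ ΣS e
    a≤e = flip-injection F (isDom-upClosed A) p (λ S → ⟦ lookup S ℓ ⟧)
            (λ S → cong ⟦_⟧ (lookup-flip-other p ℓ S ℓ≢p))
    b≤e′ : ΣS b ≤ ΣS e′
    b≤e′ = flip-injection F (isDom-upClosed A) ℓ (λ S → ⟦ lookup S p ⟧)
             (λ S → cong ⟦_⟧ (lookup-flip-other ℓ p S (λ q → ℓ≢p (≡.sym q))))
    pointwise : ∀ S → 3 * (⟦ F S ⟧ * ⟦ lookup S ℓ ⟧ + ⟦ F S ⟧ * ⟦ lookup S p ⟧) + (a S + b S)
                    ≡ 4 * ⟦ F S ⟧ + (e S + e′ S)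
    pointwise S with F S in dom | lookup S ℓ in Sℓ | lookup S p in Sp
    ... | false | _     | _     = refl
    ... | true  | true  | true  = refl
    ... | true  | true  | false = refl
    ... | true  | false | true  = refl
    ... | true  | false | false with trans (≡.sym (cong₂ _∨_ Sℓ Sp)) (pendant-dom A pend S dom)
    ...   | ()

  -- The surplus Z(v) = 2·X(v) − D of vertex v; by vertex-bound, D + Z(v) = 2·X(v).
  surplus : Fin n → ℕ
  surplus v = 2 * X v ∸ domCount A

  surplus-eq : ∀ v → domCount A + surplus v ≡ 2 * X v
  surplus-eq v = m+[n∸m]≡n (vertex-bound v)

  pair-surplus : ∀ {ℓ p} → ℓ ≢ p → Pendant A ℓ p → 2 * domCount A ≤ 3 * (surplus ℓ + surplus p)
  pair-surplus {ℓ} {p} ℓ≢p pend = +-cancelʳ-≤ (6 * d) (2 * d) (3 * (surplus ℓ + surplus p)) (begin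
      2 * d + 6 * d                              ≡⟨ id₁ d ⟩
      2 * (4 * d)                                ≤⟨ *-monoʳ-≤ 2 (pair-bound ℓ≢p pend) ⟩
      2 * (3 * (X ℓ + X p))                      ≡⟨ id₂ (X ℓ) (X p) ⟩
      3 * (2 * X ℓ + 2 * X p)                    ≡⟨ cong (3 *_) (≡.sym (cong₂ _+_ (surplus-eq ℓ) (surplus-eq p))) ⟩
      3 * ((d + surplus ℓ) + (d + surplus p))    ≡⟨ id₃ d (surplus ℓ) (surplus p) ⟩
      3 * (surplus ℓ + surplus p) + 6 * d ∎)
    where
    open ≤-Reasoning
    d = domCount A
    id₁ : ∀ d → 2 * d + 6 * d ≡ 2 * (4 * d)
    id₁ = solve-∀
    id₂ : ∀ x y → 2 * (3 * (x + y)) ≡ 3 * (2 * x + 2 * y)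
    id₂ = solve-∀
    id₃ : ∀ d x y → 3 * ((d + x) + (d + y)) ≡ 3 * (x + y) + 6 * d
    id₃ = solve-∀

  -- With two disjoint pendant edges: (3n+4)·D ≤ 6·(total size), i.e. avd ≥ (3n+4)/6.
  -- Indeed 2·Σ_v X(v) = n·D + Σ_v Z(v), and the four pendant vertices alone
  -- contribute Z ≥ 4D/3 to the last sum.
  two-pendants-bound : TwoPendantEdges A → (3 * n + 4) * domCount A ≤ 6 * domSize A
  two-pendants-bound tp = begin
      (3 * n + 4) * d                                              ≡⟨ id₁ n d ⟩
      3 * (n * d) + (2 * d + 2 * d)
        ≤⟨ +-monoʳ-≤ (3 * (n * d)) (+-mono-≤ (pair-surplus ℓ₁≢p₁ pendant₁) (pair-surplus ℓ₂≢p₂ pendant₂)) ⟩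
      3 * (n * d) + (3 * (Z ℓ₁ + Z p₁) + 3 * (Z ℓ₂ + Z p₂))        ≡⟨ id₂ (n * d) (Z ℓ₁) (Z p₁) (Z ℓ₂) (Z p₂) ⟩
      3 * (n * d + (Z ℓ₁ + (Z p₁ + (Z p₂ + (Z ℓ₂ + 0)))))
        ≤⟨ *-monoʳ-≤ 3 (+-monoʳ-≤ (n * d) (ΣV-distinct Z _ distinct)) ⟩
      3 * (n * d + ΣV Z)                ≡⟨ cong (λ x → 3 * (x + ΣV Z)) (≡.sym (ΣV-const n d)) ⟩
      3 * (ΣV {n} (λ _ → d) + ΣV Z)     ≡⟨ cong (3 *_) (≡.sym (ΣV-+ {n} (λ _ → d) Z)) ⟩
      3 * ΣV (λ v → d + Z v)            ≡⟨ cong (3 *_) (ΣV-cong surplus-eq) ⟩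
      3 * ΣV (λ v → 2 * X v)            ≡⟨ cong (3 *_) (ΣV-* 2 X) ⟩
      3 * (2 * ΣV X)                    ≡⟨ ≡.sym (*-assoc 3 2 (ΣV X)) ⟩
      6 * ΣV X                          ≡⟨ cong (6 *_) (≡.sym domSize-X) ⟩
      6 * domSize A ∎
    where
    open ≤-Reasoning
    open TwoPendantEdges tp
    d = domCount A
    Z = surplus
    id₁ : ∀ n d → (3 * n + 4) * d ≡ 3 * (n * d) + (2 * d + 2 * d)
    id₁ = solve-∀
    id₂ : ∀ m a b c e → 3 * m + (3 * (a + b) + 3 * (c + e)) ≡ 3 * (m + (a + (b + (e + (c + 0)))))
    id₂ = solve-∀
    ℓ₁≢p₁ : ℓ₁ ≢ p₁
    ℓ₁≢p₁ with distinct
    ... | (ne ∷ _) ∷ _ = ne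
    ℓ₂≢p₂ : ℓ₂ ≢ p₂
    ℓ₂≢p₂ with distinct
    ... | _ ∷ _ ∷ (ne ∷ _) ∷ _ = ≢-sym ne

starAt : ∀ {n} → Fin n → Fin n → Fin n → Bool
starAt c u v = ((u == c) ∧ not (v == c)) ∨ (not (u == c) ∧ (v == c))

isFull : ∀ {n} → Subset n → Bool
isFull S = allFin (lookup S)

coversAllBut : ∀ {n} → Fin n → Subset n → Bool
coversAllBut c S = allFin (λ v → (v == c) ∨ lookup S v)

size-all : ∀ n → 2 * ΣS {n} ∣_∣ ≡ n * 2 ^ n
size-all zero    = refl
size-all (suc n) = begin
    2 * (ΣS {n} (λ S → suc ∣ S ∣) + y)
      ≡⟨ cong (λ x → 2 * (x + y)) (trans (ΣS-+ {n} (λ _ → 1) ∣_∣) (cong (_+ y) (ΣS-one n))) ⟩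
    2 * ((2 ^ n + y) + y)     ≡⟨ id₁ (2 ^ n) y ⟩
    2 * 2 ^ n + 2 * (2 * y)   ≡⟨ cong (λ z → 2 * 2 ^ n + 2 * z) (size-all n) ⟩
    2 * 2 ^ n + 2 * (n * 2 ^ n) ≡⟨ id₂ (2 ^ n) n ⟩
    suc n * (2 * 2 ^ n) ∎
  where
  open ≡-Reasoning
  y = ΣS {n} ∣_∣
  id₁ : ∀ t y → 2 * ((t + y) + y) ≡ 2 * t + 2 * (2 * y)
  id₁ = solve-∀
  id₂ : ∀ t n → 2 * t + 2 * (n * t) ≡ suc n * (2 * t)
  id₂ = solve-∀

count-full : ∀ n → ΣS {n} (λ S → ⟦ isFull S ⟧) ≡ 1
count-full zero    = refl
count-full (suc n) = cong₂ _+_ (count-full n) (ΣS-zero {n})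

size-full : ∀ n → ΣS {n} (λ S → ⟦ isFull S ⟧ * ∣ S ∣) ≡ n
size-full zero    = refl
size-full (suc n) = begin
    ΣS {n} (λ S → ⟦ isFull S ⟧ * suc ∣ S ∣) + ΣS {n} (λ _ → 0)
      ≡⟨ cong₂ _+_ (trans (ΣS-cong {n} (λ S → *-suc ⟦ isFull S ⟧ ∣ S ∣))
                          (ΣS-+ {n} (λ S → ⟦ isFull S ⟧) (λ S → ⟦ isFull S ⟧ * ∣ S ∣))) (ΣS-zero {n}) ⟩
    (ΣS {n} (λ S → ⟦ isFull S ⟧) + ΣS {n} (λ S → ⟦ isFull S ⟧ * ∣ S ∣)) + 0
      ≡⟨ cong₂ (λ a b → (a + b) + 0) (count-full n) (size-full n) ⟩
    suc n + 0 ≡⟨ +-identityʳ (suc n) ⟩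
    suc n ∎
  where open ≡-Reasoning

count-containing : ∀ k (c : Fin (suc k)) → ΣS (λ S → ⟦ lookup S c ⟧) ≡ 2 ^ k
count-containing k       zero    = trans (cong₂ _+_ (ΣS-one k) (ΣS-zero {k})) (+-identityʳ _)
count-containing (suc k) (suc c) = cong₂ _+_ (count-containing k c)
                                     (trans (count-containing k c) (≡.sym (+-identityʳ (2 ^ k))))

count-allBut : ∀ k (c : Fin (suc k)) → ΣS (λ S → ⟦ not (lookup S c) ∧ coversAllBut c S ⟧) ≡ 1
count-allBut k       zero    = trans (cong (_+ ΣS {k} (λ S → ⟦ isFull S ⟧)) (ΣS-zero {k})) (count-full k)
count-allBut (suc k) (suc c) = cong₂ _+_ (count-allBut k c)
  (trans (ΣS-cong {suc k} (λ S → cong ⟦_⟧ (∧-zeroʳ (not (lookup S c))))) (ΣS-zero {suc k}))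

size-containing : ∀ k (c : Fin (suc k)) → 2 * ΣS (λ S → ⟦ lookup S c ⟧ * ∣ S ∣) ≡ 2 ^ suc k + k * 2 ^ k
size-containing k zero = begin
    2 * (ΣS {k} (λ S → 1 * suc ∣ S ∣) + ΣS {k} (λ _ → 0))
      ≡⟨ cong (2 *_) (cong₂ _+_ (trans (ΣS-cong {k} (λ S → *-identityˡ (suc ∣ S ∣))) (ΣS-+ {k} (λ _ → 1) ∣_∣))
                                (ΣS-zero {k})) ⟩
    2 * ((ΣS {k} (λ _ → 1) + y) + 0)  ≡⟨ cong (λ t → 2 * ((t + y) + 0)) (ΣS-one k) ⟩
    2 * ((2 ^ k + y) + 0)             ≡⟨ id₁ (2 ^ k) y ⟩
    2 * 2 ^ k + 2 * y                 ≡⟨ cong (2 * 2 ^ k +_) (size-all k) ⟩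
    2 * 2 ^ k + k * 2 ^ k ∎
  where
  open ≡-Reasoning
  y = ΣS {k} ∣_∣
  id₁ : ∀ t y → 2 * ((t + y) + 0) ≡ 2 * t + 2 * y
  id₁ = solve-∀
size-containing (suc k) (suc c) = begin
    2 * (ΣS {suc k} (λ S → ⟦ lookup S c ⟧ * suc ∣ S ∣) + y)
      ≡⟨ cong (λ x → 2 * (x + y)) (trans (ΣS-cong {suc k} (λ S → *-suc ⟦ lookup S c ⟧ ∣ S ∣))
                                      (ΣS-+ (λ S → ⟦ lookup S c ⟧) (λ S → ⟦ lookup S c ⟧ * ∣ S ∣))) ⟩
    2 * ((ΣS {suc k} (λ S → ⟦ lookup S c ⟧) + y) + y) ≡⟨ cong (λ t → 2 * ((t + y) + y)) (count-containing k c) ⟩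
    2 * ((2 ^ k + y) + y)                       ≡⟨ id₁ (2 ^ k) y ⟩
    2 * 2 ^ k + 2 * (2 * y)                     ≡⟨ cong (λ z → 2 * 2 ^ k + 2 * z) (size-containing k c) ⟩
    2 * 2 ^ k + 2 * (2 ^ suc k + k * 2 ^ k)     ≡⟨ id₂ (2 ^ k) k ⟩
    2 * (2 * 2 ^ k) + suc k * (2 * 2 ^ k) ∎
  where
  open ≡-Reasoning
  y = ΣS {suc k} (λ S → ⟦ lookup S c ⟧ * ∣ S ∣)
  id₁ : ∀ t y → 2 * ((t + y) + y) ≡ 2 * t + 2 * (2 * y)
  id₁ = solve-∀
  id₂ : ∀ t k → 2 * t + 2 * (2 * t + k * t) ≡ 2 * (2 * t) + suc k * (2 * t)
  id₂ = solve-∀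

size-allBut : ∀ k (c : Fin (suc k)) → ΣS (λ S → ⟦ not (lookup S c) ∧ coversAllBut c S ⟧ * ∣ S ∣) ≡ k
size-allBut k       zero    = trans (cong (_+ ΣS {k} (λ S → ⟦ isFull S ⟧ * ∣ S ∣)) (ΣS-zero {k})) (size-full k)
size-allBut (suc k) (suc c) = begin
    ΣS {suc k} (λ S → ⟦ P S ⟧ * suc ∣ S ∣) + ΣS {suc k} (λ S → ⟦ not (lookup S c) ∧ false ⟧ * ∣ S ∣)
      ≡⟨ cong₂ _+_ (trans (ΣS-cong {suc k} (λ S → *-suc ⟦ P S ⟧ ∣ S ∣)) (ΣS-+ (λ S → ⟦ P S ⟧) (λ S → ⟦ P S ⟧ * ∣ S ∣)))
                   (trans (ΣS-cong {suc k} (λ S → cong (λ b → ⟦ b ⟧ * ∣ S ∣) (∧-zeroʳ (not (lookup S c)))))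
                          (ΣS-zero {suc k})) ⟩
    (ΣS {suc k} (λ S → ⟦ P S ⟧) + ΣS {suc k} (λ S → ⟦ P S ⟧ * ∣ S ∣)) + 0
      ≡⟨ cong₂ (λ a b → (a + b) + 0) (count-allBut k c) (size-allBut k c) ⟩
    suc k + 0 ≡⟨ +-identityʳ (suc k) ⟩
    suc k ∎
  where
  open ≡-Reasoning
  P : Subset (suc k) → Bool
  P S = not (lookup S c) ∧ coversAllBut c S

other : ∀ {k} → Fin (suc (suc k)) → Fin (suc (suc k))
other zero    = suc zero
other (suc _) = zero

other≢ : ∀ {k} (c : Fin (suc (suc k))) → other c ≢ c
other≢ zero    ()
other≢ (suc c) ()

starAt-leaf : ∀ {n} (c u v : Fin n) → (v == c) ≡ false → starAt c u v ≡ (u == c)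
starAt-leaf c u v v≠c rewrite v≠c with u == c
... | true  = refl
... | false = refl

dom-star : ∀ k (c : Fin (suc (suc k))) S → isDom (starAt c) S ≡ lookup S c ∨ coversAllBut c S
dom-star k c S = ⇔→≡ {z = true} (mk⇔ to from)
  where
  to : isDom (starAt c) S ≡ true → lookup S c ∨ coversAllBut c S ≡ true
  to dom with lookup S c in Sc
  ... | true  = refl
  ... | false = allFin-intro (λ v → (v == c) ∨ lookup S v) leafIn
    where
    leafIn : ∀ v → (v == c) ∨ lookup S v ≡ true
    leafIn v with v == c in v=c
    ... | true  = refl
    ... | false with dominator (starAt c) S dom v
    ...   | inj₁ Sv = Sv
    ...   | inj₂ (u , Su , Auv) with ==-true u c (trans (≡.sym (starAt-leaf c u v v=c)) Auv)
    ...     | refl with trans (≡.sym Sc) Su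
    ...       | ()
  from : lookup S c ∨ coversAllBut c S ≡ true → isDom (starAt c) S ≡ true
  from h with lookup S c in Sc
  ... | true = dominates (starAt c) S viaCentre
    where
    viaCentre : ∀ v → Covered (starAt c) S v
    viaCentre v with v ≟ c
    ... | yes refl = inj₁ Sc
    ... | no  v≢c  = inj₂ (c , Sc , trans (starAt-leaf c c v (==-false v c v≢c)) (==-refl c))
  ... | false = dominates (starAt c) S viaLeaves
    where
    leafIn : ∀ v → v ≢ c → lookup S v ≡ true
    leafIn v v≢c = subst (λ b → b ∨ lookup S v ≡ true) (==-false v c v≢c) (allFin-elim (λ w → (w == c) ∨ lookup S w) h v)
    viaLeaves : ∀ v → Covered (starAt c) S v
    viaLeaves v with v ≟ c
    ... | no  v≢c  = inj₁ (leafIn v v≢c)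
    ... | yes refl = inj₂ (other c , leafIn (other c) (other≢ c) , centreAdj)
      where
      centreAdj : starAt c (other c) c ≡ true
      centreAdj rewrite ==-false (other c) c (other≢ c) | ==-refl c = refl

split∨ : ∀ a b → ⟦ a ∨ b ⟧ ≡ ⟦ a ⟧ + ⟦ not a ∧ b ⟧
split∨ true  b = refl
split∨ false b = refl

domCount-star : ∀ k (c : Fin (suc (suc k))) → domCount (starAt c) ≡ 2 ^ suc k + 1
domCount-star k c = begin
  ΣS (λ S → ⟦ isDom (starAt c) S ⟧)
    ≡⟨ ΣS-cong (λ S → trans (cong ⟦_⟧ (dom-star k c S)) (split∨ (lookup S c) (coversAllBut c S))) ⟩
  ΣS (λ S → ⟦ lookup S c ⟧ + ⟦ not (lookup S c) ∧ coversAllBut c S ⟧)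
    ≡⟨ ΣS-+ (λ S → ⟦ lookup S c ⟧) (λ S → ⟦ not (lookup S c) ∧ coversAllBut c S ⟧) ⟩
  ΣS (λ S → ⟦ lookup S c ⟧) + ΣS (λ S → ⟦ not (lookup S c) ∧ coversAllBut c S ⟧)
    ≡⟨ cong₂ _+_ (count-containing (suc k) c) (count-allBut (suc k) c) ⟩
  2 ^ suc k + 1 ∎
  where open ≡-Reasoning

domSize-star : ∀ k (c : Fin (suc (suc k))) →
  2 * domSize (starAt c) ≡ 2 ^ suc (suc k) + suc k * 2 ^ suc k + 2 * suc k
domSize-star k c = begin
  2 * ΣS (λ S → ⟦ isDom (starAt c) S ⟧ * ∣ S ∣)
    ≡⟨ cong (2 *_) (ΣS-cong (λ S → trans (cong (λ b → ⟦ b ⟧ * ∣ S ∣) (dom-star k c S))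
         (trans (cong (_* ∣ S ∣) (split∨ (lookup S c) (coversAllBut c S))) (*-distribʳ-+ ∣ S ∣ ⟦ lookup S c ⟧ _)))) ⟩
  2 * ΣS (λ S → ⟦ lookup S c ⟧ * ∣ S ∣ + ⟦ not (lookup S c) ∧ coversAllBut c S ⟧ * ∣ S ∣)
    ≡⟨ cong (2 *_) (ΣS-+ (λ S → ⟦ lookup S c ⟧ * ∣ S ∣) (λ S → ⟦ not (lookup S c) ∧ coversAllBut c S ⟧ * ∣ S ∣)) ⟩
  2 * (ΣS (λ S → ⟦ lookup S c ⟧ * ∣ S ∣) + ΣS (λ S → ⟦ not (lookup S c) ∧ coversAllBut c S ⟧ * ∣ S ∣))
    ≡⟨ *-distribˡ-+ 2 (ΣS (λ S → ⟦ lookup S c ⟧ * ∣ S ∣)) (ΣS (λ S → ⟦ not (lookup S c) ∧ coversAllBut c S ⟧ * ∣ S ∣)) ⟩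
  2 * ΣS (λ S → ⟦ lookup S c ⟧ * ∣ S ∣) + 2 * ΣS (λ S → ⟦ not (lookup S c) ∧ coversAllBut c S ⟧ * ∣ S ∣)
    ≡⟨ cong₂ _+_ (size-containing (suc k) c) (cong (2 *_) (size-allBut (suc k) c)) ⟩
  2 ^ suc (suc k) + suc k * 2 ^ suc k + 2 * suc k ∎
  where open ≡-Reasoning

IsStarAt : ∀ {n} → Fin n → (Fin n → Fin n → Bool) → Set
IsStarAt c A = ∀ u v → A u v ≡ starAt c u v

unique-reverse : ∀ {X : Set} (xs : List X) → Unique xs → Unique (reverse xs)
unique-reverse {X} xs =
  PSP.Unique-resp-↭ (setoid X) (PS.↭-sym (setoid X) (PSP.↭-reverse (setoid X) xs))

unique-drop-middle : ∀ {X : Set} (pre mid suf : List X) → Unique (pre ++ mid ++ suf) → Unique (pre ++ suf)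
unique-drop-middle []        []        suf u        = u
unique-drop-middle []        (x ∷ mid) suf (_ ∷ u)  = unique-drop-middle [] mid suf u
unique-drop-middle (p ∷ pre) mid       suf (p∉ ∷ u) =
  AllP.++⁺ (AllP.++⁻ˡ pre p∉) (AllP.++⁻ʳ mid (AllP.++⁻ʳ pre p∉)) ∷ unique-drop-middle pre mid suf u

unique-prefix : ∀ {X : Set} (pre suf : List X) → Unique (pre ++ suf) → Unique pre
unique-prefix pre suf u = subst Unique (++-identityʳ pre)
  (unique-drop-middle pre suf [] (subst (λ s → Unique (pre ++ s)) (≡.sym (++-identityʳ suf)) u))

unique-length : ∀ {N} (xs : List (Fin N)) → Unique xs → length xs ≤ N
unique-length {N} xs u with length xs ≤? N
... | yes h = h
... | no  h with FinP.pigeonhole (≰⇒> h) (lookupL xs)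
... | i , j , i<j , same = ⊥-elim (distinct-at xs u i j i<j same)
  where
  entry : ∀ {P : Fin N → Set} {ys} → All P ys → ∀ k → P (lookupL ys k)
  entry (p ∷ _)  zero    = p
  entry (_ ∷ ps) (suc k) = entry ps k
  distinct-at : ∀ ys → Unique ys → ∀ i j → i Data.Fin.< j → lookupL ys i ≢ lookupL ys j
  distinct-at (y ∷ ys) (y∉ ∷ u) zero    (suc j) _         = entry y∉ j
  distinct-at (y ∷ ys) (_ ∷ u)  (suc i) (suc j) (s≤s i<j) = distinct-at ys u i j i<j

all-or : ∀ {n} {P : Fin n → Set} {B : Set} → (∀ v → P v ⊎ B) → (∀ v → P v) ⊎ B
all-or {zero}  f = inj₁ (λ ())
all-or {suc n} {P} f with f zero
... | inj₂ b  = inj₂ b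
... | inj₁ p0 with all-or {n} {λ i → P (suc i)} (λ i → f (suc i))
...   | inj₂ b  = inj₂ b
...   | inj₁ ps = inj₁ λ { zero → p0 ; (suc i) → ps i }

module TreeStructure {n : ℕ} (G : Graph n) (acyclic : HasCycle G → ⊥) where

  open import Data.List.Membership.DecPropositional (_≟_ {n}) using (_∈?_)

  private
    A = adj G

  adjacent-distinct : ∀ {a b} → A a b ≡ true → a ≢ b
  adjacent-distinct {a} e refl with trans (≡.sym e) (irrefl G a)
  ... | ()

  no-triangle : ∀ a b c → A a b ≡ true → A b c ≡ true → A c a ≡ true → ⊥
  no-triangle a b c ab bc ca = acyclic ((a ∷ b ∷ c ∷ []) , s≤s (s≤s (s≤s z≤n)) ,
     ((adjacent-distinct ab ∷ (λ a≡c → adjacent-distinct ca (≡.sym a≡c)) ∷ []) ∷ (adjacent-distinct bc ∷ []) ∷ [] ∷ []) ,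
     (ab , bc , ca , tt))

  adj-sym : ∀ {u v} → A u v ≡ true → A v u ≡ true
  adj-sym {u} {v} uv = trans (sym G v u) uv

  non-neighbour-≢ : ∀ {c w x} → A c w ≡ false → A c x ≡ true → w ≢ x
  non-neighbour-≢ cw cx refl with trans (≡.sym cw) cx
  ... | ()

  Near : Fin n → Fin n → Set
  Near c v = v ≡ c ⊎ A c v ≡ true

  -- If every vertex is near c, the graph is the star at c (it has no triangles).
  star-from-near : ∀ c → (∀ v → Near c v) → IsStarAt c A
  star-from-near c near u v with u ≟ c | v ≟ c
  ... | yes refl | yes refl rewrite ==-refl u = irrefl G u
  ... | yes refl | no v≢c with near v
  ...   | inj₁ v≡c = ⊥-elim (v≢c v≡c)
  ...   | inj₂ cv rewrite ==-refl u | ==-false v u v≢c = cv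
  star-from-near c near u v | no u≢c | yes refl with near u
  ...   | inj₁ u≡c = ⊥-elim (u≢c u≡c)
  ...   | inj₂ cu rewrite ==-refl v | ==-false u v u≢c = adj-sym cu
  star-from-near c near u v | no u≢c | no v≢c with A u v in uv
  ...   | true  = ⊥-elim (no-triangle c u v (neighbour u u≢c) uv (adj-sym (neighbour v v≢c)))
    where
    neighbour : ∀ w → w ≢ c → A c w ≡ true
    neighbour w w≢c with near w
    ... | inj₁ w≡c = ⊥-elim (w≢c w≡c)
    ... | inj₂ cw  = cw
  ...   | false rewrite ==-false u c u≢c | ==-false v c v≢c = refl

  walk-near₁ : (∀ c a b → A c a ≡ true → A c b ≡ true → a ≡ b) →
               ∀ {c u v} → Near c u → Walk G u v → Near c v
  walk-near₁ deg near Walk.here = near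
  walk-near₁ deg (inj₁ refl) (Walk.step e rest) = walk-near₁ deg (inj₂ e) rest
  walk-near₁ deg {c} {u} (inj₂ cu) (Walk.step {w = w} e rest) =
    walk-near₁ deg (inj₁ (≡.sym (deg u c w (adj-sym cu) e))) rest

  LongPath : Set
  LongPath = Σ (List (Fin n)) λ xs → Unique xs × Chain G xs × (4 ≤ length xs)

  path4 : ∀ w u c x → A w u ≡ true → A u c ≡ true → A c x ≡ true → w ≢ c → w ≢ x → u ≢ x → LongPath
  path4 w u c x wu uc cx w≢c w≢x u≢x = (w ∷ u ∷ c ∷ x ∷ []) ,
    ((adjacent-distinct wu ∷ w≢c ∷ w≢x ∷ []) ∷ (adjacent-distinct uc ∷ u≢x ∷ []) ∷ (adjacent-distinct cx ∷ []) ∷ [] ∷ []) ,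
    (wu , uc , cx , tt) , s≤s (s≤s (s≤s (s≤s z≤n)))

  -- If c has two distinct neighbours a and b, a walk from c either stays near c or
  -- leaves it through some u ~ c into w ≁ c, giving the path w u c x with x ∈ {a, b} ∖ {u}.
  walk-near₂ : ∀ c a b → a ≢ b → A c a ≡ true → A c b ≡ true →
               ∀ {u v} → Near c u → Walk G u v → Near c v ⊎ LongPath
  walk-near₂ c a b a≢b ca cb near Walk.here = inj₁ near
  walk-near₂ c a b a≢b ca cb (inj₁ refl) (Walk.step e rest) = walk-near₂ c a b a≢b ca cb (inj₂ e) rest
  walk-near₂ c a b a≢b ca cb {u} (inj₂ cu) (Walk.step {w = w} uw rest) with w ≟ c
  ... | yes w≡c = walk-near₂ c a b a≢b ca cb (inj₁ w≡c) rest
  ... | no  w≢c with A c w in cw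
  ...   | true  = walk-near₂ c a b a≢b ca cb (inj₂ cw) rest
  ...   | false with a ≟ u
  ...     | no  a≢u  = inj₂ (path4 w u c a (adj-sym uw) (adj-sym cu) ca w≢c (non-neighbour-≢ cw ca) (≢-sym a≢u))
  ...     | yes refl = inj₂ (path4 w u c b (adj-sym uw) (adj-sym cu) cb w≢c (non-neighbour-≢ cw cb) a≢b)

  FrontMaximal : List (Fin n) → Set
  FrontMaximal []       = ⊤
  FrontMaximal (x ∷ xs) = ∀ v → A x v ≡ true → v ∈ (x ∷ xs)

  Extension : List (Fin n) → Set
  Extension xs = Σ (List (Fin n)) λ ys → Unique ys × Chain G ys × Σ (List (Fin n)) λ pre → ys ≡ pre ++ xs

  extend : ∀ f x xs → Unique (x ∷ xs) → Chain G (x ∷ xs) →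
           Σ (Extension (x ∷ xs)) λ (ys , _) → FrontMaximal ys ⊎ f + length (x ∷ xs) ≤ length ys
  extend zero x xs u ch = ((x ∷ xs) , u , ch , [] , refl) , inj₂ ≤-refl
  extend (suc f) x xs u ch with FinP.any? (λ v → (A x v ≟ᵇ true) ×-dec ¬? (v ∈? (x ∷ xs)))
  ... | yes (v , xv , v∉) with extend f v (x ∷ xs) (¬Any⇒All¬ (x ∷ xs) v∉ ∷ u) (adj-sym xv , ch)
  ...   | (ys , uy , cy , pre , ys≡) , stop =
          (ys , uy , cy , pre ++ (v ∷ []) , trans ys≡ (≡.sym (++-assoc pre (v ∷ []) (x ∷ xs)))) , longer stop
    where
    longer : FrontMaximal ys ⊎ f + length (v ∷ x ∷ xs) ≤ length ys →
             FrontMaximal ys ⊎ suc f + length (x ∷ xs) ≤ length ys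
    longer (inj₁ fm) = inj₁ fm
    longer (inj₂ le) = inj₂ (subst (_≤ length ys) (+-suc f (length (x ∷ xs))) le)
  extend (suc f) x xs u ch | no ¬new = ((x ∷ xs) , u , ch , [] , refl) , inj₁ onPath
    where
    onPath : ∀ v → A x v ≡ true → v ∈ (x ∷ xs)
    onPath v xv with v ∈? (x ∷ xs)
    ... | yes v∈ = v∈
    ... | no  v∉ = ⊥-elim (¬new (v , xv , v∉))

  -- Every path extends at its front to a front-maximal path: n + 1 extension
  -- steps would exceed the n available vertices.
  maximal : ∀ xs → Unique xs → Chain G xs → Σ (Extension xs) λ (ys , _) → FrontMaximal ys
  maximal []       u ch = ([] , u , ch , [] , refl) , tt
  maximal (x ∷ xs) u ch with extend (suc n) x xs u ch
  ... | ext , inj₁ fm = ext , fm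
  ... | (ys , uy , _) , inj₂ le =
    ⊥-elim (<-irrefl refl (≤-trans (s≤s (m≤m+n n (length (x ∷ xs)))) (≤-trans le (unique-length ys uy))))

  prefixTo : ∀ {v : Fin n} z ws → v ∈ (z ∷ ws) → List (Fin n)
  prefixTo z ws       (here _)  = []
  prefixTo z (w ∷ ws) (there q) = w ∷ prefixTo w ws q

  prefixTo-prefix : ∀ {v : Fin n} z ws (q : v ∈ (z ∷ ws)) → Σ (List (Fin n)) λ suf → prefixTo z ws q ++ suf ≡ ws
  prefixTo-prefix z ws       (here _)  = ws , refl
  prefixTo-prefix z (w ∷ ws) (there q) with prefixTo-prefix w ws q
  ... | suf , e = suf , cong (w ∷_) e

  prefixTo-chain : ∀ {v : Fin n} x z ws (q : v ∈ (z ∷ ws)) → Chain G (z ∷ ws) → A v x ≡ true →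
                   Chain G (z ∷ (prefixTo z ws q ++ (x ∷ [])))
  prefixTo-chain x z ws       (here refl) ch       vx = vx , tt
  prefixTo-chain x z (w ∷ ws) (there q)   (zw , ch) vx = zw , prefixTo-chain x w ws q ch vx

  chord-cycle : ∀ x y w ws {v} → v ∈ (w ∷ ws) → Unique (x ∷ y ∷ w ∷ ws) → Chain G (x ∷ y ∷ w ∷ ws) →
                A v x ≡ true → HasCycle G
  chord-cycle x y w ws q u (xy , ch) vx with prefixTo-prefix w ws q
  ... | suf , e = (x ∷ y ∷ w ∷ prefixTo w ws q) , s≤s (s≤s (s≤s z≤n)) ,
        unique-prefix (x ∷ y ∷ w ∷ prefixTo w ws q) suf (subst Unique (cong (λ L → x ∷ y ∷ w ∷ L) (≡.sym e)) u) ,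
        (xy , prefixTo-chain x y (w ∷ ws) (there q) ch vx)

  front-pendant : ∀ x y rest → Unique (x ∷ y ∷ rest) → Chain G (x ∷ y ∷ rest) →
                  FrontMaximal (x ∷ y ∷ rest) → Pendant A x y
  front-pendant x y rest u ch fm v vx = onPath rest u ch (fm v xv)
    where
    xv : A x v ≡ true
    xv = adj-sym vx
    onPath : ∀ rest → Unique (x ∷ y ∷ rest) → Chain G (x ∷ y ∷ rest) → v ∈ (x ∷ y ∷ rest) → v ≡ y
    onPath _        _ _  (here refl)         = ⊥-elim (adjacent-distinct xv refl)
    onPath _        _ _  (there (here refl)) = refl
    onPath (w ∷ ws) u ch (there (there q))   = ⊥-elim (acyclic (chord-cycle x y w ws q u ch vx))

  chain-reverse : ∀ xs → Chain G xs → Chain G (reverse xs)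
  chain-reverse []       _  = tt
  chain-reverse (y ∷ xs) ch = go y xs [] ch tt
    where
    go : ∀ y xs acc → Chain G (y ∷ xs) → Chain G (y ∷ acc) → Chain G (Data.List.reverseAcc (y ∷ acc) xs)
    go y []       acc _         cacc = cacc
    go y (z ∷ xs) acc (yz , cz) cacc = go z xs (y ∷ acc) cz (adj-sym yz , cacc)

  -- A front-maximal path x y rest with |rest| ≥ 2: extending its reverse maximally
  -- gives a path m m' … y x, so both ends are pendant and m, m', y, x are distinct.
  pendant-ends : ∀ x y rest → Unique (x ∷ y ∷ rest) → Chain G (x ∷ y ∷ rest) →
                 FrontMaximal (x ∷ y ∷ rest) → 2 ≤ length rest → TwoPendantEdges A
  pendant-ends x y rest u ch fm len with maximal (reverse rest ++ end) (subst Unique rev (unique-reverse _ u))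
                                                (subst (Chain G) rev (chain-reverse _ ch))
    where
    end = y ∷ x ∷ []
    rev : reverse (x ∷ y ∷ rest) ≡ reverse rest ++ end
    rev = reverse-++ (x ∷ y ∷ []) rest
  ... | (L , uL , cL , pre , L≡) , fmL =
    other-end (pre ++ reverse rest) len′ (subst Unique L≡′ uL) (subst (Chain G) L≡′ cL) (subst FrontMaximal L≡′ fmL)
    where
    end = y ∷ x ∷ []
    L≡′ : L ≡ (pre ++ reverse rest) ++ end
    L≡′ = trans L≡ (≡.sym (++-assoc pre (reverse rest) end))
    len′ : 2 ≤ length (pre ++ reverse rest)
    len′ = subst (2 ≤_) (≡.sym (trans (length-++ pre) (cong (length pre +_) (length-reverse rest))))
                 (≤-trans len (m≤n+m _ _))
    other-end : ∀ M → 2 ≤ length M → Unique (M ++ end) → Chain G (M ++ end) → FrontMaximal (M ++ end) →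
                TwoPendantEdges A
    other-end (_ ∷ [])       (s≤s ())
    other-end (m ∷ m′ ∷ mid) _ uM cM fmM = record
      { ℓ₁ = m ; p₁ = m′ ; p₂ = y ; ℓ₂ = x
      ; distinct = unique-drop-middle (m ∷ m′ ∷ []) mid end uM
      ; pendant₁ = front-pendant m m′ (mid ++ end) uM cM fmM
      ; pendant₂ = front-pendant x y rest u ch fm }

  long-path-pendants : LongPath → TwoPendantEdges A
  long-path-pendants (L₀ , u₀ , c₀ , len₀) with maximal L₀ u₀ c₀
  ... | (L , uL , cL , pre , L≡) , fmL = from-maximal L uL cL fmL
          (≤-trans len₀ (subst (length L₀ ≤_) (≡.sym (trans (cong length L≡) (length-++ pre))) (m≤n+m _ _)))
    where
    from-maximal : ∀ L → Unique L → Chain G L → FrontMaximal L → 4 ≤ length L → TwoPendantEdges A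
    from-maximal (x ∷ y ∷ rest) u ch fm (s≤s (s≤s len)) = pendant-ends x y rest u ch fm len

  star-or-pendants : Connected G → Fin n → (Σ (Fin n) λ c → IsStarAt c A) ⊎ TwoPendantEdges A
  star-or-pendants conn z
    with FinP.any? (λ c → FinP.any? (λ a → FinP.any? (λ b →
           ¬? (a ≟ b) ×-dec (A c a ≟ᵇ true) ×-dec (A c b ≟ᵇ true))))
  ... | yes (c , a , b , a≢b , ca , cb)
        with all-or (λ v → walk-near₂ c a b a≢b ca cb (inj₁ refl) (conn c v))
  ...   | inj₁ near = inj₁ (c , star-from-near c near)
  ...   | inj₂ path = inj₂ (long-path-pendants path)
  star-or-pendants conn z | no ¬branch = inj₁ (z , star-from-near z (λ v → walk-near₁ deg≤1 (inj₁ refl) (conn z v)))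
    where
    deg≤1 : ∀ c a b → A c a ≡ true → A c b ≡ true → a ≡ b
    deg≤1 c a b ca cb with a ≟ b
    ... | yes a≡b = a≡b
    ... | no  a≢b = ⊥-elim (¬branch (c , a , b , a≢b , ca , cb))

ratio-< : ∀ a b c d → a * suc d < c * suc b → ratio a (suc b) ℚ.< ratio c (suc d)
ratio-< a b c d h = ℚP.toℚᵘ-cancel-<
  (ℚᵘP.<-respˡ-≃ (ℚᵘP.≃-sym (ℚP.toℚᵘ-fromℚᵘ p)) (ℚᵘP.<-respʳ-≃ (ℚᵘP.≃-sym (ℚP.toℚᵘ-fromℚᵘ q)) p<q))
  where
  p = ℚᵘ.mkℚᵘ (ℤ.+ a) b
  q = ℚᵘ.mkℚᵘ (ℤ.+ c) d
  p<q : p ℚᵘ.< q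
  p<q = ℚᵘ.*<* (subst₂ ℤ._<_ (ℤP.pos-* a (suc d)) (ℤP.pos-* c (suc b)) (+<+ h))

linear<exponential : ∀ k → 3 * k < 2 ^ suc k + 4
linear<exponential zero          = s≤s z≤n
linear<exponential (suc zero)    = s≤s (s≤s (s≤s (s≤s z≤n)))
linear<exponential (suc (suc k)) = begin
    suc (3 * suc (suc k)) ≡⟨ id₁ k ⟩
    suc (3 * suc k) + 3   ≤⟨ +-monoˡ-≤ 3 (linear<exponential (suc k)) ⟩
    (t + 4) + 3           ≤⟨ +-monoʳ-≤ (t + 4) 3≤t ⟩
    (t + 4) + t           ≡⟨ id₂ t ⟩
    2 * t + 4 ∎
  where
  open ≤-Reasoning
  t = 2 ^ suc (suc k)
  id₁ : ∀ k → suc (3 * suc (suc k)) ≡ suc (3 * suc k) + 3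
  id₁ = solve-∀
  id₂ : ∀ t → (t + 4) + t ≡ 2 * t + 4
  id₂ = solve-∀
  id₃ : ∀ x → 4 * x ≡ 2 * (2 * x)
  id₃ = solve-∀
  3≤t : 3 ≤ t
  3≤t = ≤-trans (n≤1+n 3) (subst (4 ≤_) (id₃ (2 ^ k)) (*-monoʳ-≤ 4 (m^n>0 2 k)))

-- The star's average (twice its total size is 2^(k+2) + (k+1)·2^(k+1) + 2(k+1), over
-- 2^(k+1) + 1 dominating sets) lies strictly below any s/d with (3(k+2)+4)·d ≤ 6·s.
star-below : ∀ k s d S → (3 * suc (suc k) + 4) * suc d ≤ 6 * s →
             2 * S ≡ 2 ^ suc (suc k) + suc k * 2 ^ suc k + 2 * suc k →
             S * suc d < s * suc (2 ^ suc k)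
star-below k s d S bound 2S≡ = *-cancelˡ-< 12 (S * suc d) (s * suc t) (begin-strict
    12 * (S * suc d)                            ≡⟨ id₁ S (suc d) ⟩
    (3 * (2 * S)) * (2 * suc d)                 <⟨ *-monoˡ-< (2 * suc d) size<bound ⟩
    (c * suc t) * (2 * suc d)                   ≡⟨ id₂ c (suc t) (suc d) ⟩
    2 * suc t * (c * suc d)                     ≤⟨ *-monoʳ-≤ (2 * suc t) bound ⟩
    2 * suc t * (6 * s)                         ≡⟨ id₃ (suc t) s ⟩
    12 * (s * suc t) ∎)
  where
  open ≤-Reasoning
  t = 2 ^ suc k
  c = 3 * suc (suc k) + 4
  id₁ : ∀ S d → 12 * (S * d) ≡ (3 * (2 * S)) * (2 * d)
  id₁ = solve-∀
  id₂ : ∀ a b c → (a * b) * (2 * c) ≡ 2 * b * (a * c)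
  id₂ = solve-∀
  id₃ : ∀ b s → 2 * b * (6 * s) ≡ 12 * (s * b)
  id₃ = solve-∀
  id₄ : ∀ k t → 3 * (2 * t + (1 + k) * t + 2 * (1 + k)) + (t + 4) ≡ (3 * (2 + k) + 4) * (1 + t) + 3 * k
  id₄ = solve-∀
  size<bound : 3 * (2 * S) < c * suc t
  size<bound rewrite 2S≡ = +-cancelʳ-< (3 * k) (3 * (2 * t + suc k * t + 2 * suc k)) (c * suc t) (begin-strict
    3 * (2 * t + suc k * t + 2 * suc k) + 3 * k   <⟨ +-monoʳ-< (3 * (2 * t + suc k * t + 2 * suc k)) (linear<exponential k) ⟩
    3 * (2 * t + suc k * t + 2 * suc k) + (t + 4) ≡⟨ id₄ k t ⟩
    c * suc t + 3 * k ∎)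

star-centre0 : ∀ {n} (u v : Fin (suc n)) → star-adj u v ≡ starAt zero u v
star-centre0 zero    zero    = refl
star-centre0 zero    (suc v) = refl
star-centre0 (suc u) zero    = refl
star-centre0 (suc u) (suc v) = refl

avd-cong : ∀ {n} (G H : Graph n) → (∀ u v → adj G u v ≡ adj H u v) → avd G ≡ avd H
avd-cong G H same with counts-cong (adj G) (adj H) same
... | sizes , counts = trans (avd-sums G) (trans (cong₂ ratio sizes counts) (≡.sym (avd-sums H)))

avd-starAt : ∀ k (T : Graph (suc (suc k))) c → IsStarAt c (adj T) → avd T ≡ avd (star (suc (suc k)))
avd-starAt k T c st = begin
  avd T                                                   ≡⟨ avd-sums T ⟩
  ratio (domSize (adj T)) (domCount (adj T))              ≡⟨ cong₂ ratio (proj₁ T≈c) (proj₂ T≈c) ⟩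
  ratio (domSize (starAt c)) (domCount (starAt c))
    ≡⟨ cong₂ ratio (*-cancelˡ-≡ (domSize (starAt c)) (domSize (starAt {N} zero)) 2 (trans (domSize-star k c) (≡.sym (domSize-star k zero))))
                   (trans (domCount-star k c) (≡.sym (domCount-star k zero))) ⟩
  ratio (domSize (starAt {N} zero)) (domCount (starAt {N} zero))  ≡⟨ ≡.sym (cong₂ ratio (proj₁ star≈0) (proj₂ star≈0)) ⟩
  ratio (domSize (star-adj {N})) (domCount (star-adj {N})) ≡⟨ ≡.sym (avd-sums (star N)) ⟩
  avd (star N) ∎
  where
  open ≡-Reasoning
  N = suc (suc k)
  T≈c    = counts-cong (adj T) (starAt c) st
  star≈0 = counts-cong (star-adj {N}) (starAt {N} zero) star-centre0

isZero-transpose : ∀ {n} (c u : Fin (suc n)) → isZero (PC.transpose c zero u) ≡ (u == c)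
isZero-transpose c u with u ≟ c
... | yes refl = ≡.sym (==-refl u)
... | no u≢c with u ≟ zero
isZero-transpose zero    u | no u≢c | yes refl = ⊥-elim (u≢c refl)
isZero-transpose (suc c) u | no u≢c | yes refl = refl
isZero-transpose c zero    | no u≢c | no u≢0 = ⊥-elim (u≢0 refl)
isZero-transpose c (suc u) | no u≢c | no u≢0 = ≡.sym (==-false (suc u) c u≢c)

star-iso : ∀ {n} (T : Graph (suc n)) c → IsStarAt c (adj T) → T ≅ star (suc n)
star-iso T c st = Perm.transpose c zero , λ u v → trans (st u v)
  (≡.sym (cong₂ (λ p q → (p ∧ not q) ∨ (not p ∧ q)) (isZero-transpose c u) (isZero-transpose c v)))

-- Conversely a graph isomorphic to the star is a star, centred at the preimage of 0.
iso-star : ∀ {n} (T : Graph (suc n)) → T ≅ star (suc n) → Σ (Fin (suc n)) λ c → IsStarAt c (adj T)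
iso-star T (σ , σ-adj) = c , λ u v → trans (σ-adj u v) (cong₂ (λ p q → (p ∧ not q) ∨ (not p ∧ q)) (centre u) (centre v))
  where
  c = σ ⟨$⟩ˡ zero
  centre : ∀ u → isZero (σ ⟨$⟩ʳ u) ≡ (u == c)
  centre u with σ ⟨$⟩ʳ u in σu
  ... | zero  = ≡.sym (subst (λ x → (u == x) ≡ true) (trans (≡.sym (inverseˡ σ)) (cong (σ ⟨$⟩ˡ_) σu)) (==-refl u))
  ... | suc x = ≡.sym (==-false u c u≢c)
    where
    u≢c : u ≢ c
    u≢c refl with trans (≡.sym σu) (inverseʳ σ)
    ... | ()

single-vertex : (T : Graph 1) → IsStarAt zero (adj T)
single-vertex T zero zero = irrefl T zero

pendants-above-star : ∀ k (T : Graph (suc (suc k))) → TwoPendantEdges (adj T) →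
                      avd (star (suc (suc k))) ℚ.< avd T
pendants-above-star k T tp with domCount-pos (adj T)
... | d , D≡ = subst₂ ℚ._<_ (≡.sym avd-star) (≡.sym (trans (avd-sums T) (cong (ratio (domSize (adj T))) D≡)))
    (ratio-< size★ (2 ^ suc k) (domSize (adj T)) d
      (star-below k (domSize (adj T)) d size★
        (subst (λ x → (3 * N + 4) * x ≤ 6 * domSize (adj T)) D≡ (Counting.two-pendants-bound (adj T) tp))
        (domSize-star k zero)))
  where
  N = suc (suc k)
  size★ = domSize (starAt {N} zero)
  star≈0 = counts-cong (star-adj {N}) (starAt zero) star-centre0
  avd-star : avd (star N) ≡ ratio size★ (suc (2 ^ suc k))
  avd-star = trans (avd-sums (star N))
    (cong₂ ratio (proj₁ star≈0) (trans (proj₂ star≈0) (trans (domCount-star k zero) (+-comm (2 ^ suc k) 1))))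

star-case : ∀ {m} (T : Graph (suc m)) c → IsStarAt c (adj T) → avd T ≡ avd (star (suc m)) →
  (avd (star (suc m)) ℚ.≤ avd T) × ((avd T ≡ avd (star (suc m))) ⇔ (T ≅ star (suc m)))
star-case T c st same = ℚP.≤-reflexive (≡.sym same) , mk⇔ (λ _ → star-iso T c st) (λ _ → same)

-- A tree on one vertex is the star; a larger tree is a star (equality case) or has
-- two disjoint pendant edges (strict inequality, and then it is not a star).
theorem3p14 : (m : ℕ) (T : Graph (suc m)) → IsTree T →
    (avd (star (suc m)) ℚ.≤ avd T) × ((avd T ≡ avd (star (suc m))) ⇔ (T ≅ star (suc m)))
theorem3p14 zero T _ = star-case T zero (single-vertex T)
  (avd-cong T (star 1) λ u v → trans (single-vertex T u v) (≡.sym (star-centre0 u v)))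
theorem3p14 (suc k) T (connected , acyclic) with TreeStructure.star-or-pendants T acyclic connected zero
... | inj₁ (c , st) = star-case T c st (avd-starAt k T c st)
... | inj₂ pendants = ℚP.<⇒≤ above , mk⇔ (λ same → ⊥-elim (ℚP.<⇒≢ above (≡.sym same))) isStar⇒same
  where
  above : avd (star (suc (suc k))) ℚ.< avd T
  above = pendants-above-star k T pendants
  isStar⇒same : T ≅ star (suc (suc k)) → avd T ≡ avd (star (suc (suc k)))
  isStar⇒same iso with iso-star T iso
  ... | c , st = avd-starAt k T c st
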